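{- Let $T$ be a theory and $\vartheta,\varphi,\psi$ formulas (basic or extended case). Then the following are equivalent: (1) $T\cup\{0\le\vartheta\}\vdash_{\mathrm{lin}}\varphi\le\psi$; (2) $T\vdash_{\mathrm{lin}}\varphi+r\vartheta\le\psi$ for some $r\in\mathbb Q^+$.
   Context: $\mathbb R$-valued propositional logic. A language $L$ is a set of proposition letters; basic and extended cases. Formulas: least set containing proposition letters and the constant $0$ (and in the extended case the constant $1$), closed under binary $+$, $\wedge$ and unary $q$ for each $q\in\mathbb Q$. An inequality is an ordered pair of formulas $\varphi\le\psi$; $\varphi=\psi$ abbreviates both inequalities. A theory is a set of inequalities. $\mathbb Q^+$ is the set of nonnegative rationals (including $0$). Logical axioms (all formulas, all $r,s\in\mathbb Q$, with $-\varphi$ denoting $(-1)\varphi$): $\varphi+\psi=\psi+\varphi$; $(\varphi+\psi)+\xi=\psi+(\varphi+\xi)$; $\varphi+0=\varphi$; $1\varphi=\varphi$; $0\varphi\le0$; $r\varphi+s\varphi=(s+r)\varphi$; $r\varphi+r\psi=r(\varphi+\psi)$; $r(s\varphi)=(rs)\varphi$; $\varphi\wedge\varphi=\varphi$; $\varphi\wedge\psi=\psi\wedge\varphi$; $(\varphi\wedge\psi)\wedge\xi=\varphi\wedge(\psi\wedge\xi)$; $(\varphi+\xi)\wedge(\psi+\xi)=\varphi\wedge\psi+\xi$; $r(\varphi\wedge\psi)=r\varphi\wedge r\psi$ for $r\in\mathbb Q^+$; $\varphi\wedge\psi\le\psi$; extended case only: $-1\le P\le1$ for each proposition letter $P$.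 Rules: (r1) from $\varphi\le\xi$, $\xi\le\psi$ infer $\varphi\le\psi$; (r2) from $\varphi\le\psi$ infer $r\varphi+\xi\le r\psi+\xi$ ($r\in\mathbb Q^+$, any $\xi$). $T\vdash_{\mathrm{lin}}\varphi\le\psi$ means there is a Hilbert-style derivation of $\varphi\le\psi$ from $T$ and the logical axioms using only rules r1 and r2. -}

module Defs where

open import Data.Rational using (ℚ; 0ℚ; 1ℚ; -_; _+_; _*_; _≤_)
open import Data.Product using (_×_; _,_)
open import Data.Sum using (_⊎_)
open import Relation.Binary.PropositionalEquality using (_≡_)

-- basic case (no constant 1) / extended case (constant 1, bounds on letters)
data Case : Set where
  basic extended : Case

data Formula (L : Set) : Case → Set where
  var  : ∀ {c} → L → Formula L c
  𝟘    : ∀ {c} → Formula L c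
  𝟙    : Formula L extended
  _⊕_  : ∀ {c} → Formula L c → Formula L c → Formula L c
  _⊓_  : ∀ {c} → Formula L c → Formula L c → Formula L c
  _·_  : ∀ {c} → ℚ → Formula L c → Formula L c

infixl 6 _⊕_
infixl 7 _⊓_
infixr 8 _·_

Inequality : Set → Case → Set
Inequality L c = Formula L c × Formula L c

Theory : Set → Case → Set₁
Theory L c = Inequality L c → Set

_∪≥0_ : ∀ {L c} → Theory L c → Formula L c → Theory L c
(T ∪≥0 ϑ) ineq = T ineq ⊎ (ineq ≡ (𝟘 , ϑ))

neg : ∀ {L c} → Formula L c → Formula L c
neg φ = (- 1ℚ) · φ

-- Logical axioms stated as equalities (each yields both inequalities)
data AxEq {L : Set} {c : Case} : Formula L c → Formula L c → Set where
  +-comm   : ∀ φ ψ → AxEq (φ ⊕ ψ) (ψ ⊕ φ)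
  +-assoc  : ∀ φ ψ ξ → AxEq ((φ ⊕ ψ) ⊕ ξ) (ψ ⊕ (φ ⊕ ξ))
  +-zero   : ∀ φ → AxEq (φ ⊕ 𝟘) φ
  one-·    : ∀ φ → AxEq (1ℚ · φ) φ
  ·-distʳ  : ∀ r s φ → AxEq (r · φ ⊕ s · φ) ((s + r) · φ)
  ·-distˡ  : ∀ r φ ψ → AxEq (r · φ ⊕ r · ψ) (r · (φ ⊕ ψ))
  ·-assoc  : ∀ r s φ → AxEq (r · (s · φ)) ((r * s) · φ)
  ⊓-idem   : ∀ φ → AxEq (φ ⊓ φ) φ
  ⊓-comm   : ∀ φ ψ → AxEq (φ ⊓ ψ) (ψ ⊓ φ)
  ⊓-assoc  : ∀ φ ψ ξ → AxEq ((φ ⊓ ψ) ⊓ ξ) (φ ⊓ (ψ ⊓ ξ))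
  ⊓-+      : ∀ φ ψ ξ → AxEq ((φ ⊕ ξ) ⊓ (ψ ⊕ ξ)) ((φ ⊓ ψ) ⊕ ξ)
  ·-⊓      : ∀ r φ ψ → 0ℚ ≤ r → AxEq (r · (φ ⊓ ψ)) (r · φ ⊓ r · ψ)

data Axiom {L : Set} : {c : Case} → Formula L c → Formula L c → Set where
  eqˡ     : ∀ {c} {φ ψ : Formula L c} → AxEq φ ψ → Axiom φ ψ
  eqʳ     : ∀ {c} {φ ψ : Formula L c} → AxEq φ ψ → Axiom ψ φ
  zero-·  : ∀ {c} (φ : Formula L c) → Axiom (0ℚ · φ) 𝟘
  ⊓-≤     : ∀ {c} (φ ψ : Formula L c) → Axiom (φ ⊓ ψ) ψ
  -- extended case only: -1 ≤ P ≤ 1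
  bound-lo : (P : L) → Axiom (neg 𝟙) (var P)
  bound-hi : (P : L) → Axiom (var P) 𝟙

data _⊢lin_≤_ {L : Set} {c : Case} (T : Theory L c) : Formula L c → Formula L c → Set where
  hyp : ∀ {φ ψ} → T (φ , ψ) → T ⊢lin φ ≤ ψ
  ax  : ∀ {φ ψ} → Axiom φ ψ → T ⊢lin φ ≤ ψ
  r1  : ∀ {φ ξ ψ} → T ⊢lin φ ≤ ξ → T ⊢lin ξ ≤ ψ → T ⊢lin φ ≤ ψ
  r2  : ∀ {φ ψ} (r : ℚ) (ξ : Formula L c) → 0ℚ ≤ r →
        T ⊢lin φ ≤ ψ → T ⊢lin (r · φ ⊕ ξ) ≤ (r · ψ ⊕ ξ)

infix 4 _⊢lin_≤_

module Submission where

-- Then: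
--  * (⇐) Over any theory proving 0 ≤ ϑ we have φ ≤ φ + rϑ for r ≥ 0
--    ('absorb-multiple'); derivations over T remain derivations over the
--    larger theory T ∪ {0 ≤ ϑ} ('weaken'), and transitivity concludes.
--  * (⇒) By induction on the derivation over T ∪ {0 ≤ ϑ} we build a witness
--    of the residual form  φ + rϑ ≤ ψ  over T.  Hypotheses of T and axioms
--    take r = 0, the new hypothesis 0 ≤ ϑ takes r = 1, rule r1 adds the
--    multiples, and rule r2 with factor k multiplies the multiple by k.

open import Defs
open import Data.Rational using (ℚ; 0ℚ; 1ℚ; _≤_; _+_; _*_; nonNegative)
import Data.Rational.Properties as ℚ
open import Data.Product using (Σ; _×_; _,_)
open import Data.Sum using (inj₁; inj₂)
open import Relation.Binary.PropositionalEquality using (refl; subst)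

*-nonNeg : ∀ {p q} → 0ℚ ≤ p → 0ℚ ≤ q → 0ℚ ≤ p * q
*-nonNeg {p} {q} 0≤p 0≤q = ℚ.nonNegative⁻¹ (p * q)
  {{ℚ.nonNeg*nonNeg⇒nonNeg p {{nonNegative 0≤p}} q {{nonNegative 0≤q}}}}

0≤1 : 0ℚ ≤ 1ℚ
0≤1 = ℚ.nonNegative⁻¹ 1ℚ

weaken : ∀ {L c} {T T′ : Theory L c} → (∀ {i} → T i → T′ i) →
         ∀ {φ ψ} → T ⊢lin φ ≤ ψ → T′ ⊢lin φ ≤ ψ
weaken T⊆T′ (hyp t)      = hyp (T⊆T′ t)
weaken T⊆T′ (ax a)       = ax a
weaken T⊆T′ (r1 d e)     = r1 (weaken T⊆T′ d) (weaken T⊆T′ e)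
weaken T⊆T′ (r2 r ξ p d) = r2 r ξ p (weaken T⊆T′ d)

module DerivedRules {L : Set} {c : Case} {T : Theory L c} where

  infixr 5 _▸_

  _▸_ : ∀ {φ ξ ψ} → T ⊢lin φ ≤ ξ → T ⊢lin ξ ≤ ψ → T ⊢lin φ ≤ ψ
  _▸_ = r1

  ≈⇒≤ : ∀ {φ ψ} → AxEq φ ψ → T ⊢lin φ ≤ ψ
  ≈⇒≤ e = ax (eqˡ e)

  ≈⇒≥ : ∀ {φ ψ} → AxEq φ ψ → T ⊢lin ψ ≤ φ
  ≈⇒≥ e = ax (eqʳ e)

  -- Adding ξ on the right preserves ≤ (r2 with factor 1, then 1ξ = ξ).
  add-right : ∀ {φ ψ} ξ → T ⊢lin φ ≤ ψ → T ⊢lin φ ⊕ ξ ≤ ψ ⊕ ξ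
  add-right {φ} {ψ} ξ φ≤ψ =
    ≈⇒≥ (one-· _) ▸ ≈⇒≥ (·-distˡ 1ℚ φ ξ)
    ▸ r2 1ℚ (1ℚ · ξ) 0≤1 φ≤ψ
    ▸ ≈⇒≤ (·-distˡ 1ℚ ψ ξ) ▸ ≈⇒≤ (one-· _)

  add-left : ∀ {φ ψ} ξ → T ⊢lin φ ≤ ψ → T ⊢lin ξ ⊕ φ ≤ ξ ⊕ ψ
  add-left ξ φ≤ψ = ≈⇒≤ (+-comm _ _) ▸ add-right ξ φ≤ψ ▸ ≈⇒≤ (+-comm _ _)

  -- Scaling by r ≥ 0 preserves ≤ (r2 with ξ = 0).
  scale : ∀ {φ ψ} r → 0ℚ ≤ r → T ⊢lin φ ≤ ψ → T ⊢lin r · φ ≤ r · ψ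
  scale r 0≤r φ≤ψ = ≈⇒≥ (+-zero _) ▸ r2 r 𝟘 0≤r φ≤ψ ▸ ≈⇒≤ (+-zero _)

  regroup : ∀ φ ψ ξ → T ⊢lin φ ⊕ (ψ ⊕ ξ) ≤ (φ ⊕ ψ) ⊕ ξ
  regroup φ ψ ξ = ≈⇒≥ (+-assoc ψ φ ξ) ▸ add-right ξ (≈⇒≤ (+-comm ψ φ))

  swap-last : ∀ φ ψ ξ → T ⊢lin (φ ⊕ ψ) ⊕ ξ ≤ (φ ⊕ ξ) ⊕ ψ
  swap-last φ ψ ξ =
    add-right ξ (≈⇒≤ (+-comm _ _)) ▸ ≈⇒≤ (+-assoc ψ φ ξ)
    ▸ add-left φ (≈⇒≤ (+-comm _ _)) ▸ ≈⇒≥ (+-assoc ξ φ ψ)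
    ▸ add-right ψ (≈⇒≤ (+-comm _ _))

  drop-zero-multiple : ∀ φ ϑ → T ⊢lin φ ⊕ 0ℚ · ϑ ≤ φ
  drop-zero-multiple φ ϑ = add-left φ (ax (zero-· ϑ)) ▸ ≈⇒≤ (+-zero φ)

  -- 0 ≤ 0·0, via 0 = 1·0 = (1 + 0)·0 = 0·0 + 1·0 = 0·0 + 0 = 0·0.
  𝟘≤zero-multiple-of-𝟘 : T ⊢lin 𝟘 ≤ 0ℚ · 𝟘
  𝟘≤zero-multiple-of-𝟘 =
    ≈⇒≥ (one-· 𝟘)
    ▸ subst (λ q → T ⊢lin q · 𝟘 ≤ 0ℚ · 𝟘 ⊕ 1ℚ · 𝟘)
            (ℚ.+-identityʳ 1ℚ) (≈⇒≥ (·-distʳ 0ℚ 1ℚ 𝟘))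
    ▸ add-left (0ℚ · 𝟘) (≈⇒≤ (one-· 𝟘)) ▸ ≈⇒≤ (+-zero _)

  -- 0 ≤ r·0 for r ≥ 0, since 0·0 = (r·0)·0 = r·(0·0) ≤ r·0.
  𝟘≤multiple-of-𝟘 : ∀ r → 0ℚ ≤ r → T ⊢lin 𝟘 ≤ r · 𝟘
  𝟘≤multiple-of-𝟘 r 0≤r =
    𝟘≤zero-multiple-of-𝟘
    ▸ subst (λ q → T ⊢lin q · 𝟘 ≤ r · (0ℚ · 𝟘)) (ℚ.*-zeroʳ r) (≈⇒≥ (·-assoc r 0ℚ 𝟘))
    ▸ scale r 0≤r (ax (zero-· 𝟘))

  absorb-multiple : ∀ {ϑ} φ r → 0ℚ ≤ r → T ⊢lin 𝟘 ≤ ϑ → T ⊢lin φ ≤ φ ⊕ r · ϑ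
  absorb-multiple φ r 0≤r 0≤ϑ =
    ≈⇒≥ (+-zero φ) ▸ add-left φ (𝟘≤multiple-of-𝟘 r 0≤r ▸ scale r 0≤r 0≤ϑ)

open DerivedRules

ResidualDerivation : ∀ {L c} → Theory L c → (ϑ φ ψ : Formula L c) → Set
ResidualDerivation T ϑ φ ψ = Σ ℚ (λ r → 0ℚ ≤ r × T ⊢lin φ ⊕ r · ϑ ≤ ψ)

module _ {L : Set} {c : Case} {T : Theory L c} (ϑ : Formula L c) where

  residual-of-derivation : ∀ {φ ψ} → T ⊢lin φ ≤ ψ → ResidualDerivation T ϑ φ ψ
  residual-of-derivation φ≤ψ = 0ℚ , ℚ.≤-refl , drop-zero-multiple _ ϑ ▸ φ≤ψ

  residual-of-hypothesis : ResidualDerivation T ϑ 𝟘 ϑ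
  residual-of-hypothesis =
    1ℚ , 0≤1 , ≈⇒≤ (+-comm _ _) ▸ ≈⇒≤ (+-zero _) ▸ ≈⇒≤ (one-· _)

  -- Rule r1: φ + (s + r)ϑ = φ + (rϑ + sϑ) ≤ (φ + rϑ) + sϑ ≤ ξ + sϑ ≤ ψ.
  residual-r1 : ∀ {φ ξ ψ} → ResidualDerivation T ϑ φ ξ →
                ResidualDerivation T ϑ ξ ψ → ResidualDerivation T ϑ φ ψ
  residual-r1 {φ} (r , 0≤r , φ≤ξ) (s , 0≤s , ξ≤ψ) =
    s + r , ℚ.+-mono-≤ 0≤s 0≤r ,
    add-left φ (≈⇒≥ (·-distʳ r s ϑ)) ▸ regroup φ (r · ϑ) (s · ϑ)
    ▸ add-right (s · ϑ) φ≤ξ ▸ ξ≤ψ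

  -- Rule r2: (kφ + ξ) + (kr)ϑ ≤ (kφ + k(rϑ)) + ξ = k(φ + rϑ) + ξ ≤ kψ + ξ.
  residual-r2 : ∀ {φ ψ} k ξ → 0ℚ ≤ k → ResidualDerivation T ϑ φ ψ →
                ResidualDerivation T ϑ (k · φ ⊕ ξ) (k · ψ ⊕ ξ)
  residual-r2 {φ} k ξ 0≤k (r , 0≤r , φ≤ψ) =
    k * r , *-nonNeg 0≤k 0≤r ,
    swap-last (k · φ) ξ ((k * r) · ϑ)
    ▸ add-right ξ (add-left (k · φ) (≈⇒≥ (·-assoc k r ϑ))
                  ▸ ≈⇒≤ (·-distˡ k φ (r · ϑ)))
    ▸ r2 k ξ 0≤k φ≤ψ

  eliminate-hypothesis : ∀ {φ ψ} → (T ∪≥0 ϑ) ⊢lin φ ≤ ψ → ResidualDerivation T ϑ φ ψ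
  eliminate-hypothesis (hyp (inj₁ t))    = residual-of-derivation (hyp t)
  eliminate-hypothesis (hyp (inj₂ refl)) = residual-of-hypothesis
  eliminate-hypothesis (ax a)            = residual-of-derivation (ax a)
  eliminate-hypothesis (r1 d e)          =
    residual-r1 (eliminate-hypothesis d) (eliminate-hypothesis e)
  eliminate-hypothesis (r2 k ξ 0≤k d)    = residual-r2 k ξ 0≤k (eliminate-hypothesis d)

  introduce-hypothesis : ∀ {φ ψ} → ResidualDerivation T ϑ φ ψ → (T ∪≥0 ϑ) ⊢lin φ ≤ ψ
  introduce-hypothesis {φ} (r , 0≤r , φ+rϑ≤ψ) =
    absorb-multiple φ r 0≤r (hyp (inj₂ refl)) ▸ weaken inj₁ φ+rϑ≤ψ

mainTheorem7 : {L : Set} {c : Case} (T : Theory L c) (ϑ φ ψ : Formula L c) →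
    ((T ∪≥0 ϑ) ⊢lin φ ≤ ψ → Σ ℚ (λ r → 0ℚ ≤ r × T ⊢lin φ ⊕ r · ϑ ≤ ψ))
    × (Σ ℚ (λ r → 0ℚ ≤ r × T ⊢lin φ ⊕ r · ϑ ≤ ψ) → (T ∪≥0 ϑ) ⊢lin φ ≤ ψ)
mainTheorem7 T ϑ φ ψ = eliminate-hypothesis ϑ , introduce-hypothesis ϑ
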